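{- Let $G=(V,E)$ be a connected $d$-regular graph and let $k\in\mathbb{R}$ be such that $\kappa(v_1,v_2)\geq k$ for every pair of distinct vertices $v_1,v_2\in V$. Fix $x\in V$ and for $i\ge 0$ let $S_i=\{v\in V:\mathrm{dist}(x,v)=i\}$. Then for every $i\geq 1$, $$|S_{i+1}|\leq \frac{d+1-2dk}{2}\,|S_i|.$$
   Context: $\mathrm{dist}$ is the graph distance. For a vertex $x$ of degree $d_x$, $\mu_x$ is the probability measure on $V$ with $\mu_x(x)=\tfrac12$, $\mu_x(v)=\tfrac{1}{2d_x}$ if $v\sim x$, and $\mu_x(v)=0$ otherwise. For probability measures $\mu,\nu$ of finite support, $W_1(\mu,\nu)=\inf_m\sum_{u,v}\mathrm{dist}(u,v)\,m(u,v)$, the infimum over couplings $m$ of $\mu$ and $\nu$. The Ollivier curvature of distinct vertices $x,y$ is $\kappa(x,y)=1-\frac{W_1(\mu_x,\mu_y)}{\mathrm{dist}(x,y)}$.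
   Formalization: The curvature lower bound k is taken in ℚ rather than ℝ, and the couplings in the infimum defining $W_1$ have rational entries. -}

module Defs where

open import Data.Nat as ℕ using (ℕ; zero; suc)
open import Data.Integer using (+_)
open import Data.Fin using (Fin; zero; suc)
open import Data.Vec using (Vec; _∷_; lookup)
open import Data.Vec.Membership.Propositional using (_∈_)
open import Data.List using (List; length)
open import Data.List.Relation.Unary.Unique.Propositional using (Unique)
import Data.List.Membership.Propositional as LM
open import Data.Rational using (ℚ; _/_; _+_; _*_; _-_; _<_; _≤_; 0ℚ; ½)
open import Data.Product using (Σ; _×_; _,_; ∃)
open import Function.Definitions using (Injective)
open import Relation.Binary.PropositionalEquality using (_≡_; _≢_)
open import Relation.Nullary using (¬_)
open import Function.Bundles using (_⇔_)

ℕ→ℚ : ℕ → ℚ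
ℕ→ℚ n = + n / 1

sumFin : (n : ℕ) → (Fin n → ℚ) → ℚ
sumFin zero    f = 0ℚ
sumFin (suc n) f = f zero + sumFin n (λ i → f (suc i))

-- A d-regular simple graph on a (possibly infinite) vertex type V,
-- given by its neighbour lists: nbr x lists the d neighbours of x.
record RegularGraph (V : Set) (d : ℕ) : Set₁ where
  field
    nbr       : V → Vec V d
    nbr-inj   : ∀ x → Injective _≡_ _≡_ (lookup (nbr x))   -- no multi-edges
    loopless  : ∀ x → ¬ (x ∈ nbr x)
    symmetric : ∀ x y → y ∈ nbr x → x ∈ nbr y

module _ {V : Set} {d : ℕ} (G : RegularGraph V d) where
  open RegularGraph G

  Adj : V → V → Set
  Adj u v = v ∈ nbr u

  data Walk : V → V → ℕ → Set where
    here : ∀ {u} → Walk u u 0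
    step : ∀ {u v w n} → Adj u v → Walk v w n → Walk u w (suc n)

  Connected : Set
  Connected = ∀ u v → ∃ λ n → Walk u v n

  IsGraphDist : (V → V → ℕ) → Set
  IsGraphDist dist = ∀ u v → Walk u v (dist u v) × (∀ n → Walk u v n → dist u v ℕ.≤ n)

  -- Closed neighbourhood  x, nbr x  indexed by Fin (suc d): position 0 is x.
  ball1 : V → Fin (suc d) → V
  ball1 x zero    = x
  ball1 x (suc j) = lookup (nbr x) j

  -- Mass 1/(2d) on each neighbour (only used when d ≥ 1).
  nbrMass : ℕ → ℚ
  nbrMass zero    = 0ℚ
  nbrMass (suc n) = + 1 / (suc n ℕ.+ suc n)

  -- μ_x evaluated at the i-th point of the closed neighbourhood of x
  -- (μ_x vanishes outside it; the points are pairwise distinct).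
  μ : Fin (suc d) → ℚ
  μ zero    = ½
  μ (suc j) = nbrMass d

  -- Couplings of μ_x and μ_y (supported on ball1 x × ball1 y).
  record Coupling : Set where
    field
      m        : Fin (suc d) → Fin (suc d) → ℚ
      nonneg   : ∀ i j → 0ℚ ≤ m i j
      marginal₁ : ∀ i → sumFin (suc d) (λ j → m i j) ≡ μ i
      marginal₂ : ∀ j → sumFin (suc d) (λ i → m i j) ≡ μ j

  cost : (V → V → ℕ) → V → V → Coupling → ℚ
  cost dist x y c = sumFin (suc d) λ i → sumFin (suc d) λ j →
    ℕ→ℚ (dist (ball1 x i) (ball1 y j)) * Coupling.m c i j

  -- W₁(μ_x, μ_y) ≤ r, unfolding the infimum: for every ε > 0 some coupling
  -- has cost < r + ε.
  W1≤ : (V → V → ℕ) → V → V → ℚ → Set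
  W1≤ dist x y r = ∀ ε → 0ℚ < ε → Σ Coupling λ c → cost dist x y c < r + ε

  -- κ(x,y) ≥ k  ⇔  1 - W₁/dist ≥ k  ⇔  W₁ ≤ (1 - k)·dist(x,y).
  CurvatureAtLeast : (V → V → ℕ) → V → V → ℚ → Set
  CurvatureAtLeast dist x y k = W1≤ dist x y ((Data.Rational.1ℚ - k) * ℕ→ℚ (dist x y))

  Enumerates : (V → V → ℕ) → V → ℕ → List V → Set
  Enumerates dist x i L = Unique L × (∀ v → (v LM.∈ L) ⇔ (dist x v ≡ i))

module Submission where

-- For y ∈ S_i let F_y be the indicator of {y} ∪ {levels > i} plus the
-- indicator of the sole children of y (vertices of S_{i+1} adjacent to y and to
-- no other vertex of S_i).  F_y is 1-Lipschitz, so by the easy half of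
-- Kantorovich duality its mean grows by at most W₁(μ_w, μ_y) ≤ 1 - k from μ_w to
-- μ_y, w a neighbour of y in S_{i-1}.  Computing both means gives the local bound
-- T y ≤ d + 1 - 2dk for the total T y of F_y over the neighbours of y.  Double
-- counting the edges between S_i and S_{i+1} gives 2|S_{i+1}| ≤ Σ_{y ∈ S_i} T y:
-- a sole child receives 2 from its parent, any other vertex of S_{i+1} at least 1
-- from each of its (at least two) parents.

open import Defs
open import Data.Nat using (ℕ; zero; suc; _≥_)
open import Data.List using (List; length)
open import Data.Rational using (ℚ; _≤_; _*_; _+_; _-_; ½; 1ℚ)
open import Relation.Binary.PropositionalEquality using (_≢_)

import Data.Nat as ℕ
import Data.Nat.Properties as ℕ
import Data.Nat.Coprimality as Coprime
import Data.Integer as ℤ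
import Data.Integer.Properties as ℤ
open import Data.Rational using (0ℚ; mkℚ; _<_; -_; nonNegative; NonNegative)
import Data.Rational.Properties as ℚ
open import Data.Rational.Solver using (module +-*-Solver)
open +-*-Solver using (solve; _:+_; _:-_; _:*_; _:=_; con)
open import Algebra.Bundles using (Ring)
open import Algebra.Properties.CommutativeSemigroup ℕ.+-commutativeSemigroup using (interchange)
open import Algebra.Properties.Semiring.Sum (Ring.semiring ℚ.+-*-ring)
  using (sum; sum-cong-≗; *-distribˡ-sum)
  renaming (∑-comm to sum-comm; ∑-distrib-+ to sum-distrib-+)

open import Data.Fin using (Fin; zero; suc)
open import Data.Product using (Σ; _×_; _,_; proj₁; proj₂)
open import Data.Sum using (_⊎_; inj₁; inj₂)
open import Data.List using ([]; _∷_; tabulate)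
open import Data.List.Membership.Propositional using (_∈_; find)
open import Data.List.Membership.Propositional.Properties using (∈-tabulate⁺; ∈-tabulate⁻)
open import Data.List.Relation.Unary.Any using (here; there)
open import Data.List.Relation.Unary.All using (All; all?)
import Data.List.Relation.Unary.All as All
open import Data.List.Relation.Unary.All.Properties using (¬All⇒Any¬)
open import Data.List.Relation.Unary.AllPairs using ([]; _∷_)
open import Data.List.Relation.Unary.Unique.Propositional using (Unique)
open import Data.List.Relation.Unary.Unique.Propositional.Properties using (tabulate⁺)
open import Data.Vec using (Vec; lookup)
open import Data.Vec.Membership.Propositional using () renaming (_∈_ to _∈ᵥ_)
open import Data.Vec.Membership.Propositional.Properties using (∈-lookup)
import Data.Vec.Relation.Unary.Any as Anyᵥ
open import Data.Vec.Relation.Unary.Any.Properties using (lookup-index)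
open import Function using (_∘_)
open import Function.Bundles using (Equivalence)
open import Relation.Binary.Definitions using (DecidableEquality)
open import Relation.Binary.PropositionalEquality
  using (_≡_; refl; sym; trans; cong; cong₂; subst; module ≡-Reasoning)
open import Relation.Nullary using (¬_; Dec; yes; no; contradiction)
open import Relation.Nullary.Decidable
  using (map′; decidable-stable; _×-dec_; _⊎-dec_; _→-dec_)

-- ℕ→ℚ n is the normal form n/1; exposing it lets ℚ-arithmetic on casts compute.
ℕ→ℚ-normal : ∀ n → ℕ→ℚ n ≡ mkℚ (ℤ.+ n) 0 (Coprime.sym (Coprime.1-coprimeTo n))
ℕ→ℚ-normal n = ℚ.normalize-coprime (Coprime.sym (Coprime.1-coprimeTo n))

ℕ→ℚ-+ : ∀ a b → ℕ→ℚ (a ℕ.+ b) ≡ ℕ→ℚ a + ℕ→ℚ b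
ℕ→ℚ-+ a b = begin
  ℕ→ℚ (a ℕ.+ b)
    ≡⟨ ℚ./-cong {p₁ = ℤ.+ (a ℕ.+ b)} numerator refl ⟩
  (ℤ.+ a ℤ.* ℤ.+ 1 ℤ.+ ℤ.+ b ℤ.* ℤ.+ 1) / 1
    ≡⟨ cong₂ _+_ (ℕ→ℚ-normal a) (ℕ→ℚ-normal b) ⟨
  ℕ→ℚ a + ℕ→ℚ b ∎
  where
  open ≡-Reasoning
  open Data.Rational using (_/_)
  numerator : ℤ.+ (a ℕ.+ b) ≡ ℤ.+ a ℤ.* ℤ.+ 1 ℤ.+ ℤ.+ b ℤ.* ℤ.+ 1
  numerator = sym (cong₂ ℤ._+_ (ℤ.*-identityʳ (ℤ.+ a)) (ℤ.*-identityʳ (ℤ.+ b)))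

ℕ→ℚ-nonneg : ∀ n → 0ℚ ≤ ℕ→ℚ n
ℕ→ℚ-nonneg n = ℚ.nonNegative⁻¹ _ {{ℚ.normalize-nonNeg n 1}}

ℕ→ℚ-mono : ∀ {a b} → a ℕ.≤ b → ℕ→ℚ a ≤ ℕ→ℚ b
ℕ→ℚ-mono {a} {b} a≤b = begin
  ℕ→ℚ a                   ≡⟨ ℚ.+-identityʳ (ℕ→ℚ a) ⟨
  ℕ→ℚ a + 0ℚ              ≤⟨ ℚ.+-monoʳ-≤ (ℕ→ℚ a) (ℕ→ℚ-nonneg (b ℕ.∸ a)) ⟩
  ℕ→ℚ a + ℕ→ℚ (b ℕ.∸ a)   ≡⟨ ℕ→ℚ-+ a (b ℕ.∸ a) ⟨
  ℕ→ℚ (a ℕ.+ (b ℕ.∸ a))   ≡⟨ cong ℕ→ℚ (ℕ.m+[n∸m]≡n a≤b) ⟩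
  ℕ→ℚ b                   ∎
  where open ℚ.≤-Reasoning

ℕ→ℚ-half-double : ∀ n → ℕ→ℚ n ≡ ½ * ℕ→ℚ (2 ℕ.* n)
ℕ→ℚ-half-double n = begin
  ℕ→ℚ n                          ≡⟨ solve 1 (λ N → N := con ½ :* (N :+ N)) refl (ℕ→ℚ n) ⟩
  ½ * (ℕ→ℚ n + ℕ→ℚ n)            ≡⟨ cong (½ *_) (ℕ→ℚ-+ n n) ⟨
  ½ * ℕ→ℚ (n ℕ.+ n)              ≡⟨ cong (λ m → ½ * ℕ→ℚ (n ℕ.+ m)) (ℕ.+-identityʳ n) ⟨
  ½ * ℕ→ℚ (2 ℕ.* n)              ∎
  where open ≡-Reasoning

nbrMass-inverse : ∀ {V} {d} (G : RegularGraph V d) → 0 ℕ.< d →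
  nbrMass G d * ℕ→ℚ (d ℕ.+ d) ≡ 1ℚ
nbrMass-inverse {d = suc d} G _ = trans
  (cong₂ _*_ (ℚ.normalize-coprime (Coprime.1-coprimeTo n)) (ℕ→ℚ-normal n))
  (ℚ.*-inverseˡ (mkℚ (ℤ.+ n) 0 (Coprime.sym (Coprime.1-coprimeTo n))))
  where n = suc d ℕ.+ suc d

nbrMass-nonneg : ∀ {V} {d} (G : RegularGraph V d) n → 0ℚ ≤ nbrMass G n
nbrMass-nonneg G zero    = ℚ.≤-refl
nbrMass-nonneg G (suc n) = ℚ.nonNegative⁻¹ _ {{ℚ.normalize-nonNeg 1 (suc n ℕ.+ suc n)}}

solve-for-t : ∀ (d t : ℕ) (c k : ℚ) → c * ℕ→ℚ (d ℕ.+ d) ≡ 1ℚ →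
  ½ + ℕ→ℚ t * c ≤ (1ℚ - k) + c → ℕ→ℚ t ≤ ℕ→ℚ d + 1ℚ - ℕ→ℚ 2 * ℕ→ℚ d * k
solve-for-t d t c k c·2d≡1 h = begin
  T
    ≡⟨ ℚ.*-identityʳ T ⟨
  T * 1ℚ
    ≡⟨ cong (T *_) c·[D+D]≡1 ⟨
  T * (c * (D + D))
    ≡⟨ solve 3 (λ D T c → T :* (c :* (D :+ D)) := (D :+ D) :* (con ½ :+ T :* c) :- D) refl D T c ⟩
  (D + D) * (½ + T * c) - D
    ≤⟨ ℚ.+-monoˡ-≤ (- D) (ℚ.*-monoˡ-≤-nonNeg (D + D) {{2D-nonneg}} h) ⟩
  (D + D) * ((1ℚ - k) + c) - D
    ≡⟨ solve 3 (λ D c k → (D :+ D) :* ((con 1ℚ :- k) :+ c) :- D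
                            := D :+ c :* (D :+ D) :- con (ℕ→ℚ 2) :* D :* k) refl D c k ⟩
  D + c * (D + D) - ℕ→ℚ 2 * D * k
    ≡⟨ cong (λ e → D + e - ℕ→ℚ 2 * D * k) c·[D+D]≡1 ⟩
  D + 1ℚ - ℕ→ℚ 2 * D * k ∎
  where
  open ℚ.≤-Reasoning
  T D : ℚ
  T = ℕ→ℚ t
  D = ℕ→ℚ d
  c·[D+D]≡1 : c * (D + D) ≡ 1ℚ
  c·[D+D]≡1 = trans (cong (c *_) (sym (ℕ→ℚ-+ d d))) c·2d≡1
  2D-nonneg : NonNegative (D + D)
  2D-nonneg = nonNegative (subst (0ℚ ≤_) (ℕ→ℚ-+ d d) (ℕ→ℚ-nonneg (d ℕ.+ d)))

𝟙 : {P : Set} → Dec P → ℕ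
𝟙 (yes _) = 1
𝟙 (no _)  = 0

𝟙-yes : {P : Set} (p? : Dec P) → P → 𝟙 p? ≡ 1
𝟙-yes (yes _) _ = refl
𝟙-yes (no ¬p) p = contradiction p ¬p

𝟙-no : {P : Set} (p? : Dec P) → ¬ P → 𝟙 p? ≡ 0
𝟙-no (yes p) ¬p = contradiction p ¬p
𝟙-no (no _)  _  = refl

𝟙≤1 : {P : Set} (p? : Dec P) → 𝟙 p? ℕ.≤ 1
𝟙≤1 (yes _) = ℕ.≤-refl
𝟙≤1 (no _)  = ℕ.z≤n

𝟙-witness : {P : Set} (p? : Dec P) → 𝟙 p? ≢ 0 → P
𝟙-witness (yes p) _   = p
𝟙-witness (no _)  𝟙≢0 = contradiction refl 𝟙≢0

𝟙-mono : {P Q : Set} (p? : Dec P) (q? : Dec Q) → (P → Q) → 𝟙 p? ℕ.≤ 𝟙 q?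
𝟙-mono (yes p) q? P⇒Q = ℕ.≤-reflexive (sym (𝟙-yes q? (P⇒Q p)))
𝟙-mono (no _)  q? P⇒Q = ℕ.z≤n

-- Sum of a ℕ-valued function along a list (a list without duplicates is a finite set).
∑ : {A : Set} → List A → (A → ℕ) → ℕ
∑ []       f = 0
∑ (a ∷ as) f = f a ℕ.+ ∑ as f

module _ {A : Set} where

  ∑-cong : ∀ (L : List A) {f g : A → ℕ} → (∀ {a} → a ∈ L → f a ≡ g a) → ∑ L f ≡ ∑ L g
  ∑-cong []      f≗g = refl
  ∑-cong (a ∷ L) f≗g = cong₂ ℕ._+_ (f≗g (here refl)) (∑-cong L (f≗g ∘ there))

  ∑-mono : ∀ (L : List A) {f g : A → ℕ} → (∀ {a} → a ∈ L → f a ℕ.≤ g a) → ∑ L f ℕ.≤ ∑ L g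
  ∑-mono []      f≤g = ℕ.z≤n
  ∑-mono (a ∷ L) f≤g = ℕ.+-mono-≤ (f≤g (here refl)) (∑-mono L (f≤g ∘ there))

  ∑-zero : ∀ (L : List A) → ∑ L (λ _ → 0) ≡ 0
  ∑-zero []      = refl
  ∑-zero (a ∷ L) = ∑-zero L

  ∑-distrib-+ : ∀ (L : List A) (f g : A → ℕ) → ∑ L (λ a → f a ℕ.+ g a) ≡ ∑ L f ℕ.+ ∑ L g
  ∑-distrib-+ []      f g = refl
  ∑-distrib-+ (a ∷ L) f g = begin
    (f a ℕ.+ g a) ℕ.+ ∑ L (λ a → f a ℕ.+ g a)   ≡⟨ cong ((f a ℕ.+ g a) ℕ.+_) (∑-distrib-+ L f g) ⟩
    (f a ℕ.+ g a) ℕ.+ (∑ L f ℕ.+ ∑ L g)         ≡⟨ interchange (f a) (g a) (∑ L f) (∑ L g) ⟩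
    (f a ℕ.+ ∑ L f) ℕ.+ (g a ℕ.+ ∑ L g)         ∎
    where open ≡-Reasoning

  ∑-distribʳ-* : ∀ (L : List A) (f : A → ℕ) c → ∑ L (λ a → f a ℕ.* c) ≡ ∑ L f ℕ.* c
  ∑-distribʳ-* []      f c = refl
  ∑-distribʳ-* (a ∷ L) f c =
    trans (cong (f a ℕ.* c ℕ.+_) (∑-distribʳ-* L f c)) (sym (ℕ.*-distribʳ-+ c (f a) (∑ L f)))

  ∑-const : ∀ (L : List A) c → ∑ L (λ _ → c) ≡ length L ℕ.* c
  ∑-const []      c = refl
  ∑-const (a ∷ L) c = cong (c ℕ.+_) (∑-const L c)

  ∑-member : ∀ {L : List A} (f : A → ℕ) {a} → a ∈ L → f a ℕ.≤ ∑ L f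
  ∑-member f (here refl)  = ℕ.m≤m+n _ _
  ∑-member f (there a∈L) = ℕ.≤-trans (∑-member f a∈L) (ℕ.m≤n+m _ _)

  ∑-occurrences≤1 : (_≟_ : DecidableEquality A) (a : A) {L : List A} → Unique L →
    ∑ L (λ u → 𝟙 (a ≟ u)) ℕ.≤ 1
  ∑-occurrences≤1 _≟_ a {[]}    []           = ℕ.z≤n
  ∑-occurrences≤1 _≟_ a {u ∷ L} (u∉L ∷ uniq) with a ≟ u
  ... | no _     = ∑-occurrences≤1 _≟_ a uniq
  ... | yes refl = ℕ.+-monoʳ-≤ 1 (ℕ.≤-trans (∑-mono L absent) (ℕ.≤-reflexive (∑-zero L)))
    where
    absent : ∀ {v} → v ∈ L → 𝟙 (a ≟ v) ℕ.≤ 0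
    absent v∈L = ℕ.≤-reflexive (𝟙-no (a ≟ _) (All.lookup u∉L v∈L))

∑-swap : ∀ {A B : Set} (L : List A) (M : List B) (f : A → B → ℕ) →
  ∑ L (λ a → ∑ M (f a)) ≡ ∑ M (λ b → ∑ L (λ a → f a b))
∑-swap []      M f = sym (∑-zero M)
∑-swap (a ∷ L) M f = trans (cong (∑ M (f a) ℕ.+_) (∑-swap L M f)) (sym (∑-distrib-+ M (f a) _))

module _ {A : Set} (_≟_ : DecidableEquality A) where

  ∑-≤-support : {L M : List A} (g : A → ℕ) → Unique L →
    (∀ {z} → z ∈ L → g z ≢ 0 → z ∈ M) → ∑ L g ℕ.≤ ∑ M g
  ∑-≤-support {L} {M} g uniq support = begin
    ∑ L g
      ≤⟨ ∑-mono L covered ⟩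
    ∑ L (λ z → ∑ M (λ u → 𝟙 (u ≟ z) ℕ.* g u))
      ≡⟨ ∑-swap L M _ ⟩
    ∑ M (λ u → ∑ L (λ z → 𝟙 (u ≟ z) ℕ.* g u))
      ≡⟨ ∑-cong M (λ {u} _ → ∑-distribʳ-* L (λ z → 𝟙 (u ≟ z)) (g u)) ⟩
    ∑ M (λ u → ∑ L (λ z → 𝟙 (u ≟ z)) ℕ.* g u)
      ≤⟨ ∑-mono M (λ {u} _ → ℕ.*-monoˡ-≤ (g u) (∑-occurrences≤1 _≟_ u uniq)) ⟩
    ∑ M (λ u → 1 ℕ.* g u)
      ≡⟨ ∑-cong M (λ {u} _ → ℕ.*-identityˡ (g u)) ⟩
    ∑ M g ∎
    where
    open ℕ.≤-Reasoning
    -- each g z is recovered from the term u = z of the inner sum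
    covered : ∀ {z} → z ∈ L → g z ℕ.≤ ∑ M (λ u → 𝟙 (u ≟ z) ℕ.* g u)
    covered {z} z∈L with g z ℕ.≟ 0
    ... | yes gz≡0 = ℕ.≤-trans (ℕ.≤-reflexive gz≡0) ℕ.z≤n
    ... | no  gz≢0 = subst (ℕ._≤ ∑ M term) diagonal (∑-member term (support z∈L gz≢0))
      where
      term : A → ℕ
      term u = 𝟙 (u ≟ z) ℕ.* g u
      diagonal : 𝟙 (z ≟ z) ℕ.* g z ≡ g z
      diagonal = trans (cong (ℕ._* g z) (𝟙-yes (z ≟ z) refl)) (ℕ.*-identityˡ (g z))

  ∑-pair : {L : List A} (f : A → ℕ) {a b : A} → Unique L → a ∈ L → b ∈ L → a ≢ b →
    f a ℕ.+ f b ℕ.≤ ∑ L f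
  ∑-pair {L} f {a} {b} uniq a∈L b∈L a≢b =
    subst (ℕ._≤ ∑ L f) (cong (f a ℕ.+_) (ℕ.+-identityʳ (f b)))
      (∑-≤-support f ((a≢b All.∷ All.[]) ∷ All.[] ∷ []) pair⊆L)
    where
    pair⊆L : ∀ {z} → z ∈ a ∷ b ∷ [] → f z ≢ 0 → z ∈ L
    pair⊆L (here refl)         _ = a∈L
    pair⊆L (there (here refl)) _ = b∈L

ℕ→ℚ-∑-≤ : ∀ {A : Set} (L : List A) (f : A → ℕ) (r : ℚ) →
  (∀ {a} → a ∈ L → ℕ→ℚ (f a) ≤ r) → ℕ→ℚ (∑ L f) ≤ ℕ→ℚ (length L) * r
ℕ→ℚ-∑-≤ []      f r bound = ℚ.≤-reflexive (sym (ℚ.*-zeroˡ r))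
ℕ→ℚ-∑-≤ (a ∷ L) f r bound = begin
  ℕ→ℚ (f a ℕ.+ ∑ L f)              ≡⟨ ℕ→ℚ-+ (f a) (∑ L f) ⟩
  ℕ→ℚ (f a) + ℕ→ℚ (∑ L f)          ≤⟨ ℚ.+-mono-≤ (bound (here refl)) (ℕ→ℚ-∑-≤ L f r (bound ∘ there)) ⟩
  r + ℕ→ℚ (length L) * r           ≡⟨ cong (_+ ℕ→ℚ (length L) * r) (ℚ.*-identityˡ r) ⟨
  1ℚ * r + ℕ→ℚ (length L) * r      ≡⟨ ℚ.*-distribʳ-+ r 1ℚ (ℕ→ℚ (length L)) ⟨
  (1ℚ + ℕ→ℚ (length L)) * r        ≡⟨ cong (_* r) (ℕ→ℚ-+ 1 (length L)) ⟨
  ℕ→ℚ (suc (length L)) * r         ∎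
  where open ℚ.≤-Reasoning

sumFin≡sum : ∀ n (f : Fin n → ℚ) → sumFin n f ≡ sum f
sumFin≡sum zero    f = refl
sumFin≡sum (suc n) f = cong (f zero +_) (sumFin≡sum n (f ∘ suc))

sum-mono : ∀ {n} {f g : Fin n → ℚ} → (∀ i → f i ≤ g i) → sum f ≤ sum g
sum-mono {zero}  f≤g = ℚ.≤-refl
sum-mono {suc n} f≤g = ℚ.+-mono-≤ (f≤g zero) (sum-mono (f≤g ∘ suc))

sumFin-tabulate : ∀ {A : Set} n (f : Fin n → A) (g : A → ℕ) (c : ℚ) →
  sumFin n (λ j → ℕ→ℚ (g (f j)) * c) ≡ ℕ→ℚ (∑ (tabulate f) g) * c
sumFin-tabulate zero    f g c = sym (ℚ.*-zeroˡ c)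
sumFin-tabulate (suc n) f g c = begin
  ℕ→ℚ (g (f zero)) * c + sumFin n (λ j → ℕ→ℚ (g (f (suc j))) * c)
    ≡⟨ cong (ℕ→ℚ (g (f zero)) * c +_) (sumFin-tabulate n (f ∘ suc) g c) ⟩
  ℕ→ℚ (g (f zero)) * c + ℕ→ℚ (∑ (tabulate (f ∘ suc)) g) * c
    ≡⟨ ℚ.*-distribʳ-+ c (ℕ→ℚ (g (f zero))) _ ⟨
  (ℕ→ℚ (g (f zero)) + ℕ→ℚ (∑ (tabulate (f ∘ suc)) g)) * c
    ≡⟨ cong (_* c) (ℕ→ℚ-+ (g (f zero)) _) ⟨
  ℕ→ℚ (∑ (tabulate f) g) * c ∎
  where open ≡-Reasoning

module Neighbours {V : Set} {d : ℕ} (G : RegularGraph V d) where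
  open RegularGraph G

  nbrs : V → List V
  nbrs v = tabulate (lookup (nbr v))

  Adj⇒degree>0 : ∀ {u v} → Adj G u v → 0 ℕ.< d
  Adj⇒degree>0 {u} = nonempty
    where
    nonempty : ∀ {n} {xs : Vec V n} {v} → v ∈ᵥ xs → 0 ℕ.< n
    nonempty (Anyᵥ.here _)  = ℕ.z<s
    nonempty (Anyᵥ.there _) = ℕ.z<s

  nbrs-unique : ∀ v → Unique (nbrs v)
  nbrs-unique v = tabulate⁺ (nbr-inj v)

  ∈nbrs⇒Adj : ∀ {v u} → u ∈ nbrs v → Adj G v u
  ∈nbrs⇒Adj {v} u∈ with ∈-tabulate⁻ u∈
  ... | j , refl = ∈-lookup j (nbr v)

  Adj⇒∈nbrs : ∀ {v u} → Adj G v u → u ∈ nbrs v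
  Adj⇒∈nbrs {v} v~u = subst (_∈ nbrs v) (sym (lookup-index v~u)) (∈-tabulate⁺ (Anyᵥ.index v~u))

module GraphMetric {V : Set} {d : ℕ} (G : RegularGraph V d)
                   (dist : V → V → ℕ) (isDist : IsGraphDist G dist) where
  open RegularGraph G

  private
    unsnoc : ∀ {u w n} → Walk G u w (suc n) → Σ V λ v → Walk G u v n × Adj G v w
    unsnoc (step a here)       = _ , here , a
    unsnoc (step a (step b p)) with unsnoc (step b p)
    ... | v , q , c = v , step a q , c

    snoc : ∀ {u v w n} → Walk G u v n → Adj G v w → Walk G u w (suc n)
    snoc here        a = step a here
    snoc (step b p) a = step b (snoc p a)

    geodesic : ∀ u v → Walk G u v (dist u v)
    geodesic u v = proj₁ (isDist u v)

    dist-minimal : ∀ {u v n} → Walk G u v n → dist u v ℕ.≤ n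
    dist-minimal {u} {v} = proj₂ (isDist u v) _

  dist≡0⇒≡ : ∀ {u v} → dist u v ≡ 0 → u ≡ v
  dist≡0⇒≡ {u} {v} d≡0 with dist u v | geodesic u v
  dist≡0⇒≡ refl | .0 | here = refl

  dist-refl : ∀ u → dist u u ≡ 0
  dist-refl u = ℕ.n≤0⇒n≡0 (dist-minimal here)

  _≟ᵥ_ : DecidableEquality V
  u ≟ᵥ v = map′ dist≡0⇒≡ (λ { refl → dist-refl u }) (dist u v ℕ.≟ 0)

  Adj⇒≢ : ∀ {u v} → Adj G u v → u ≢ v
  Adj⇒≢ {u} u~u refl = loopless u u~u

  dist≡1⇒Adj : ∀ {u v} → dist u v ≡ 1 → Adj G u v
  dist≡1⇒Adj {u} {v} d≡1 with dist u v | geodesic u v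
  dist≡1⇒Adj refl | .1 | step u~v here = u~v

  Adj⇒dist≡1 : ∀ {u v} → Adj G u v → dist u v ≡ 1
  Adj⇒dist≡1 {u} {v} u~v = ℕ.≤-antisym (dist-minimal (step u~v here)) (ℕ.n≢0⇒n>0 d≢0)
    where
    d≢0 : dist u v ≢ 0
    d≢0 d≡0 = Adj⇒≢ u~v (dist≡0⇒≡ d≡0)

  dist-step : ∀ u {v w} → Adj G v w → dist u w ℕ.≤ suc (dist u v)
  dist-step u {v} v~w = dist-minimal (snoc (geodesic u v) v~w)

  parent : ∀ {u z n} → dist u z ≡ suc n → Σ V λ p → dist u p ≡ n × Adj G p z
  parent {u} {z} {n} d≡1+n with unsnoc (subst (Walk G u z) d≡1+n (geodesic u z))
  ... | p , u⇝p , p~z = p , ℕ.≤-antisym (dist-minimal u⇝p) n≤dist , p~z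
    where
    n≤dist : n ℕ.≤ dist u p
    n≤dist = ℕ.≤-pred (subst (ℕ._≤ suc (dist u p)) d≡1+n (dist-step u p~z))

≤-from-ε : ∀ {p q : ℚ} → (∀ ε → 0ℚ < ε → p < q + ε) → p ≤ q
≤-from-ε {p} {q} p<q+ε with p ℚ.≤? q
... | yes p≤q = p≤q
... | no  p≰q = contradiction (subst (p <_) q+[p-q]≡p (p<q+ε (p - q) 0<p-q)) (ℚ.<-irrefl refl)
  where
  0<p-q : 0ℚ < p - q
  0<p-q = subst (_< p - q) (ℚ.+-inverseʳ q) (ℚ.+-monoˡ-< (- q) (ℚ.≰⇒> p≰q))
  q+[p-q]≡p : q + (p - q) ≡ p
  q+[p-q]≡p = solve 2 (λ p q → q :+ (p :- q) := p) refl p q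

-- The easy half of Kantorovich duality: W₁(μ_a, μ_b) bounds from above how much
-- the mean of a 1-Lipschitz function can grow from μ_a to μ_b.
module Transport {V : Set} {d : ℕ} (G : RegularGraph V d) (dist : V → V → ℕ) where
  open RegularGraph G using (nbr)
  open Neighbours G

  Lipschitz : (V → ℕ) → Set
  Lipschitz F = ∀ a b → F b ℕ.≤ dist a b ℕ.+ F a

  mean : V → (V → ℕ) → ℚ
  mean a F = sumFin (suc d) (λ j → ℕ→ℚ (F (ball1 G a j)) * μ G j)

  mean-split : ∀ a F → mean a F ≡ ℕ→ℚ (F a) * ½ + ℕ→ℚ (∑ (nbrs a) F) * nbrMass G d
  mean-split a F = cong (ℕ→ℚ (F a) * ½ +_) (sumFin-tabulate d (lookup (nbr a)) F (nbrMass G d))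

  mean≤cost+mean : ∀ {F} → Lipschitz F → ∀ a b (c : Coupling G) →
    mean b F ≤ cost G dist a b c + mean a F
  mean≤cost+mean {F} F-lip a b c = begin
    mean b F
      ≡⟨ sumFin≡sum n (λ j → B j * μ G j) ⟩
    sum (λ j → B j * μ G j)
      ≡⟨ sum-cong-≗ (λ j → cong (B j *_) (marginal₂ j)) ⟨
    sum (λ j → B j * sum (λ i → m i j))
      ≡⟨ sum-cong-≗ (λ j → *-distribˡ-sum (B j) (λ i → m i j)) ⟩
    sum (λ j → sum (λ i → B j * m i j))
      ≡⟨ sum-comm (λ i j → B j * m i j) ⟨
    sum (λ i → sum (λ j → B j * m i j))
      ≤⟨ sum-mono (λ i → sum-mono (λ j → transport-step i j)) ⟩
    sum (λ i → sum (λ j → D i j * m i j + A i * m i j))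
      ≡⟨ sum-cong-≗ (λ i → sum-distrib-+ (λ j → D i j * m i j) (λ j → A i * m i j)) ⟩
    sum (λ i → sum (λ j → D i j * m i j) + sum (λ j → A i * m i j))
      ≡⟨ sum-distrib-+ (λ i → sum (λ j → D i j * m i j)) (λ i → sum (λ j → A i * m i j)) ⟩
    sum (λ i → sum (λ j → D i j * m i j)) + sum (λ i → sum (λ j → A i * m i j))
      ≡⟨ cong₂ _+_ cost≡ (sum-cong-≗ (λ i → *-distribˡ-sum (A i) (m i))) ⟨
    cost G dist a b c + sum (λ i → A i * sum (m i))
      ≡⟨ cong (cost G dist a b c +_) (sum-cong-≗ (λ i → cong (A i *_) (marginal₁ i))) ⟩
    cost G dist a b c + sum (λ i → A i * μ G i)
      ≡⟨ cong (cost G dist a b c +_) (sumFin≡sum n (λ i → A i * μ G i)) ⟨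
    cost G dist a b c + mean a F ∎
    where
    open ℚ.≤-Reasoning
    n : ℕ
    n = suc d
    m : Fin n → Fin n → ℚ
    m = Coupling.m c
    A B : Fin n → ℚ
    A i = ℕ→ℚ (F (ball1 G a i))
    B j = ℕ→ℚ (F (ball1 G b j))
    D : Fin n → Fin n → ℚ
    D i j = ℕ→ℚ (dist (ball1 G a i) (ball1 G b j))
    marginal₁ : ∀ i → sum (m i) ≡ μ G i
    marginal₁ i = trans (sym (sumFin≡sum n (m i))) (Coupling.marginal₁ c i)
    marginal₂ : ∀ j → sum (λ i → m i j) ≡ μ G j
    marginal₂ j = trans (sym (sumFin≡sum n (λ i → m i j))) (Coupling.marginal₂ c j)
    cost≡ : cost G dist a b c ≡ sum (λ i → sum (λ j → D i j * m i j))
    cost≡ = trans (sumFin≡sum n (λ i → sumFin n (λ j → D i j * m i j)))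
                  (sum-cong-≗ (λ i → sumFin≡sum n (λ j → D i j * m i j)))
    -- moving the mass m i j from ball1 a i to ball1 b j raises F by at most D i j
    transport-step : ∀ i j → B j * m i j ≤ D i j * m i j + A i * m i j
    transport-step i j = begin
      B j * m i j          ≤⟨ ℚ.*-monoʳ-≤-nonNeg (m i j) {{nonNegative (Coupling.nonneg c i j)}} B≤D+A ⟩
      (D i j + A i) * m i j ≡⟨ ℚ.*-distribʳ-+ (m i j) (D i j) (A i) ⟩
      D i j * m i j + A i * m i j ∎
      where
      B≤D+A : B j ≤ D i j + A i
      B≤D+A = subst (B j ≤_) (ℕ→ℚ-+ (dist (ball1 G a i) (ball1 G b j)) (F (ball1 G a i)))
                (ℕ→ℚ-mono (F-lip (ball1 G a i) (ball1 G b j)))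

  mean≤W₁+mean : ∀ {F} → Lipschitz F → ∀ {a b r} → W1≤ G dist a b r → mean b F ≤ r + mean a F
  mean≤W₁+mean {F} F-lip {a} {b} {r} W₁≤r = ≤-from-ε λ ε ε>0 →
    let (c , cost<r+ε) = W₁≤r ε ε>0 in begin-strict
      mean b F
        ≤⟨ mean≤cost+mean F-lip a b c ⟩
      cost G dist a b c + mean a F
        <⟨ ℚ.+-monoˡ-< (mean a F) cost<r+ε ⟩
      (r + ε) + mean a F
        ≡⟨ solve 3 (λ r ε M → (r :+ ε) :+ M := (r :+ M) :+ ε) refl r ε (mean a F) ⟩
      (r + mean a F) + ε ∎
    where open ℚ.≤-Reasoning

module Levels {V : Set} {d : ℕ} (G : RegularGraph V d) (dist : V → V → ℕ)
              (isDist : IsGraphDist G dist) (x : V) (i : ℕ) where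
  open RegularGraph G
  open Neighbours G
  open GraphMetric G dist isDist
  open Transport G dist

  lv : V → ℕ
  lv = dist x

  OnlyParent : V → V → Set
  OnlyParent y v = All (λ u → lv u ≡ i → u ≡ y) (nbrs v)

  SoleChild : V → V → Set
  SoleChild y v = lv v ≡ suc i × dist y v ≡ 1 × OnlyParent y v

  soleChild? : ∀ y v → Dec (SoleChild y v)
  soleChild? y v = lv v ℕ.≟ suc i ×-dec dist y v ℕ.≟ 1
                   ×-dec all? (λ u → (lv u ℕ.≟ i) →-dec (u ≟ᵥ y)) (nbrs v)

  Raised : V → V → Set
  Raised y v = y ≡ v ⊎ i ℕ.< lv v

  raised? : ∀ y v → Dec (Raised y v)
  raised? y v = (y ≟ᵥ v) ⊎-dec (suc i ℕ.≤? lv v)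

  -- The test function of y: the indicator of the raised vertices plus the
  -- indicator of the sole children of y (which are raised too, so F y ≤ 2).
  F : V → V → ℕ
  F y v = 𝟙 (raised? y v) ℕ.+ 𝟙 (soleChild? y v)

  F-raised : ∀ {y v} → Raised y v → 1 ℕ.≤ F y v
  F-raised {y} {v} r = ℕ.≤-trans (ℕ.≤-reflexive (sym (𝟙-yes (raised? y v) r))) (ℕ.m≤m+n _ _)

  F-sole : ∀ {y v} → SoleChild y v → F y v ≡ 2
  F-sole {y} {v} sole@(lv≡1+i , _) =
    cong₂ ℕ._+_ (𝟙-yes (raised? y v) (inj₂ (ℕ.≤-reflexive (sym lv≡1+i)))) (𝟙-yes (soleChild? y v) sole)

  F-not-sole : ∀ {y v} → ¬ SoleChild y v → F y v ≡ 𝟙 (raised? y v)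
  F-not-sole {y} {v} ¬sole =
    trans (cong (𝟙 (raised? y v) ℕ.+_) (𝟙-no (soleChild? y v) ¬sole)) (ℕ.+-identityʳ _)

  F≤2 : ∀ y v → F y v ℕ.≤ 2
  F≤2 y v = ℕ.+-mono-≤ (𝟙≤1 (raised? y v)) (𝟙≤1 (soleChild? y v))

  F-below : ∀ {y v} → lv v ℕ.≤ i → F y v ℕ.≤ 𝟙 (y ≟ᵥ v)
  F-below {y} {v} lv≤i = begin
    F y v             ≡⟨ F-not-sole not-sole ⟩
    𝟙 (raised? y v)   ≤⟨ 𝟙-mono (raised? y v) (y ≟ᵥ v) only-y ⟩
    𝟙 (y ≟ᵥ v)        ∎
    where
    open ℕ.≤-Reasoning
    not-low : ¬ (i ℕ.< lv v)
    not-low i<lv = ℕ.<-irrefl refl (ℕ.<-≤-trans i<lv lv≤i)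
    not-sole : ¬ SoleChild y v
    not-sole (lv≡1+i , _) = not-low (ℕ.≤-reflexive (sym lv≡1+i))
    only-y : Raised y v → y ≡ v
    only-y (inj₁ y≡v)  = y≡v
    only-y (inj₂ i<lv) = contradiction i<lv not-low

  sole-child-nbr-raised : ∀ {y a b} → SoleChild y b → Adj G a b → Raised y a
  sole-child-nbr-raised {y} {a} {b} (lvb≡1+i , _ , only) a~b with lv a ℕ.≟ i
  ... | yes lva≡i = inj₁ (sym (All.lookup only (Adj⇒∈nbrs (symmetric a b a~b)) lva≡i))
  ... | no  lva≢i = inj₂ (ℕ.≤∧≢⇒< i≤lva (lva≢i ∘ sym))
    where
    i≤lva : i ℕ.≤ lv a
    i≤lva = ℕ.≤-pred (subst (ℕ._≤ suc (lv a)) lvb≡1+i (dist-step x a~b))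

  -- Across an edge F y grows by at most 1: a jump of 2 could only end at a
  -- sole child of y, and then the start of the edge is raised.
  F-edge : ∀ y {a b} → Adj G a b → F y b ℕ.≤ suc (F y a)
  F-edge y {a} {b} a~b = by-cases (soleChild? y b)
    where
    by-cases : Dec (SoleChild y b) → F y b ℕ.≤ suc (F y a)
    by-cases (yes sole) = ℕ.≤-trans (ℕ.≤-reflexive (F-sole sole))
                            (ℕ.s≤s (F-raised (sole-child-nbr-raised sole a~b)))
    by-cases (no ¬sole) = ℕ.≤-trans (ℕ.≤-reflexive (F-not-sole ¬sole))
                            (ℕ.≤-trans (𝟙≤1 (raised? y b)) (ℕ.m≤m+n 1 (F y a)))

  -- F y is 1-Lipschitz: distance 0 is trivial, distance 1 is F-edge, and
  -- distance ≥ 2 is covered since F y ≤ 2.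
  F-lipschitz : ∀ y → Lipschitz (F y)
  F-lipschitz y a b with dist a b in dab
  ... | zero        = subst (λ v → F y v ℕ.≤ F y a) (dist≡0⇒≡ dab) ℕ.≤-refl
  ... | suc zero    = F-edge y (dist≡1⇒Adj dab)
  ... | suc (suc n) = ℕ.≤-trans (F≤2 y b) (ℕ.≤-trans (ℕ.m≤m+n 2 n) (ℕ.m≤m+n (2 ℕ.+ n) (F y a)))

  T : V → ℕ
  T y = ∑ (nbrs y) (F y)

  -- F y is 1 at y itself, so under μ_y its mean is ½ + T y/(2d).
  mean-at-centre : ∀ {y} → lv y ≡ i → mean y (F y) ≡ ½ + ℕ→ℚ (T y) * nbrMass G d
  mean-at-centre {y} lvy≡i = begin
    mean y (F y)
      ≡⟨ mean-split y (F y) ⟩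
    ℕ→ℚ (F y y) * ½ + ℕ→ℚ (T y) * nbrMass G d
      ≡⟨ cong (λ n → ℕ→ℚ n * ½ + ℕ→ℚ (T y) * nbrMass G d) F-y≡1 ⟩
    1ℚ * ½ + ℕ→ℚ (T y) * nbrMass G d
      ≡⟨ cong (_+ ℕ→ℚ (T y) * nbrMass G d) (ℚ.*-identityˡ ½) ⟩
    ½ + ℕ→ℚ (T y) * nbrMass G d ∎
    where
    open ≡-Reasoning
    F-y≡1 : F y y ≡ 1
    F-y≡1 = ℕ.≤-antisym (ℕ.≤-trans (F-below (ℕ.≤-reflexive lvy≡i)) (𝟙≤1 (y ≟ᵥ y)))
                        (F-raised (inj₁ refl))

  -- Below level i, μ_w sees F y only through the single point y.
  mean-below : ∀ {y w} → y ≢ w → lv w ℕ.< i → mean w (F y) ≤ nbrMass G d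
  mean-below {y} {w} y≢w lvw<i = begin
    mean w (F y)
      ≡⟨ mean-split w (F y) ⟩
    ℕ→ℚ (F y w) * ½ + ℕ→ℚ (∑ (nbrs w) (F y)) * nbrMass G d
      ≤⟨ ℚ.+-mono-≤ (ℚ.*-monoʳ-≤-nonNeg ½ (ℕ→ℚ-mono F-w≡0))
                    (ℚ.*-monoʳ-≤-nonNeg (nbrMass G d) {{c-nonneg}} (ℕ→ℚ-mono y-once)) ⟩
    0ℚ * ½ + 1ℚ * nbrMass G d
      ≡⟨ solve 1 (λ c → con 0ℚ :* con ½ :+ con 1ℚ :* c := c) refl (nbrMass G d) ⟩
    nbrMass G d ∎
    where
    open ℚ.≤-Reasoning
    c-nonneg : NonNegative (nbrMass G d)
    c-nonneg = nonNegative (nbrMass-nonneg G d)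
    F-w≡0 : F y w ℕ.≤ 0
    F-w≡0 = ℕ.≤-trans (F-below (ℕ.<⇒≤ lvw<i)) (ℕ.≤-reflexive (𝟙-no (y ≟ᵥ w) y≢w))
    y-once : ∑ (nbrs w) (F y) ℕ.≤ 1
    y-once = ℕ.≤-trans (∑-mono (nbrs w) (λ u∈ → F-below (ℕ.≤-trans (dist-step x (∈nbrs⇒Adj u∈)) lvw<i)))
                       (∑-occurrences≤1 _≟ᵥ_ y (nbrs-unique w))

  lower-parent : 1 ℕ.≤ i → ∀ {y} → lv y ≡ i → Σ V λ w → lv w ℕ.< i × Adj G w y
  lower-parent 1≤i {y} lvy≡i = via (ℕ.pred i) (sym (ℕ.suc-pred i {{ℕ.>-nonZero 1≤i}}))
    where
    via : ∀ j → i ≡ suc j → Σ V λ w → lv w ℕ.< i × Adj G w y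
    via j i≡1+j with parent (trans lvy≡i i≡1+j)
    ... | w , lvw≡j , w~y = w , subst (lv w ℕ.<_) (sym i≡1+j) (ℕ.s≤s (ℕ.≤-reflexive lvw≡j)) , w~y

  -- Local bound: T y ≤ d + 1 - 2dk for y on level i ≥ 1, obtained by comparing
  -- the means of F y under μ_y and under μ_w for a lower neighbour w of y.
  local-bound : ∀ (k : ℚ) → (∀ v₁ v₂ → v₁ ≢ v₂ → CurvatureAtLeast G dist v₁ v₂ k) →
    1 ℕ.≤ i → ∀ {y} → lv y ≡ i → ℕ→ℚ (T y) ≤ ℕ→ℚ d + 1ℚ - ℕ→ℚ 2 * ℕ→ℚ d * k
  local-bound k curv 1≤i {y} lvy≡i with lower-parent 1≤i lvy≡i
  ... | w , lvw<i , w~y = solve-for-t d (T y) c k (nbrMass-inverse G (Adj⇒degree>0 w~y)) (begin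
    ½ + ℕ→ℚ (T y) * c
      ≡⟨ mean-at-centre lvy≡i ⟨
    mean y (F y)
      ≤⟨ mean≤W₁+mean (F-lipschitz y) {r = r} W₁≤r ⟩
    (1ℚ - k) * ℕ→ℚ (dist w y) + mean w (F y)
      ≡⟨ cong (λ n → (1ℚ - k) * ℕ→ℚ n + mean w (F y)) (Adj⇒dist≡1 w~y) ⟩
    (1ℚ - k) * 1ℚ + mean w (F y)
      ≤⟨ ℚ.+-mono-≤ (ℚ.≤-reflexive (ℚ.*-identityʳ (1ℚ - k))) (mean-below (Adj⇒≢ w~y ∘ sym) lvw<i) ⟩
    (1ℚ - k) + c ∎)
    where
    open ℚ.≤-Reasoning
    c : ℚ
    c = nbrMass G d
    r : ℚ
    r = (1ℚ - k) * ℕ→ℚ (dist w y)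
    W₁≤r : W1≤ G dist w y r
    W₁≤r = curv w y (Adj⇒≢ w~y)

  another-parent : ∀ {y v} → ¬ OnlyParent y v → Σ V λ u → Adj G v u × lv u ≡ i × u ≢ y
  another-parent {y} {v} ¬only
    with find (¬All⇒Any¬ (λ u → (lv u ℕ.≟ i) →-dec (u ≟ᵥ y)) (nbrs v) ¬only)
  ... | u , u∈nbrs , ¬[lv≡i⇒u≡y] = u , ∈nbrs⇒Adj u∈nbrs , lvu≡i , (λ u≡y → ¬[lv≡i⇒u≡y] (λ _ → u≡y))
    where
    lvu≡i : lv u ≡ i
    lvu≡i = decidable-stable (lv u ℕ.≟ i) (λ lvu≢i → ¬[lv≡i⇒u≡y] (λ lvu≡i → contradiction lvu≡i lvu≢i))

  -- Inc y z: the share of F y received by z, namely F y z if z is a neighbour of y.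
  Inc : V → V → ℕ
  Inc y z = 𝟙 (dist y z ℕ.≟ 1) ℕ.* F y z

  Inc-adjacent : ∀ {y z} → Adj G y z → Inc y z ≡ F y z
  Inc-adjacent {y} {z} y~z =
    trans (cong (ℕ._* F y z) (𝟙-yes (dist y z ℕ.≟ 1) (Adj⇒dist≡1 y~z))) (ℕ.*-identityˡ (F y z))

  Inc-≤-T : ∀ {L} → Unique L → ∀ y → ∑ L (Inc y) ℕ.≤ T y
  Inc-≤-T {L} uniq y = begin
    ∑ L (Inc y)          ≤⟨ ∑-≤-support _≟ᵥ_ (Inc y) uniq only-nbrs ⟩
    ∑ (nbrs y) (Inc y)   ≡⟨ ∑-cong (nbrs y) (Inc-adjacent ∘ ∈nbrs⇒Adj) ⟩
    T y                  ∎
    where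
    open ℕ.≤-Reasoning
    only-nbrs : ∀ {z} → z ∈ L → Inc y z ≢ 0 → z ∈ nbrs y
    only-nbrs {z} _ Inc≢0 = Adj⇒∈nbrs (dist≡1⇒Adj (𝟙-witness (dist y z ℕ.≟ 1) 𝟙≢0))
      where
      𝟙≢0 : 𝟙 (dist y z ℕ.≟ 1) ≢ 0
      𝟙≢0 𝟙≡0 = Inc≢0 (cong (ℕ._* F y z) 𝟙≡0)

  -- Every z on level i+1 collects at least 2 from S_i: 2 from its parent if that
  -- parent is its only one, and otherwise at least 1 from each of two parents.
  Inc-≥-2 : ∀ {Sᵢ} → Enumerates G dist x i Sᵢ → ∀ {z} → lv z ≡ suc i → 2 ℕ.≤ ∑ Sᵢ (λ y → Inc y z)
  Inc-≥-2 {Sᵢ} (uniq , enum) {z} lvz≡1+i with parent lvz≡1+i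
  ... | p , lvp≡i , p~z = by-cases (soleChild? p z)
    where
    in-Sᵢ : ∀ {u} → lv u ≡ i → u ∈ Sᵢ
    in-Sᵢ = Equivalence.from (enum _)
    gives-1 : ∀ {u} → Adj G u z → 1 ℕ.≤ Inc u z
    gives-1 u~z = subst (1 ℕ.≤_) (sym (Inc-adjacent u~z)) (F-raised (inj₂ (ℕ.≤-reflexive (sym lvz≡1+i))))
    by-cases : Dec (SoleChild p z) → 2 ℕ.≤ ∑ Sᵢ (λ y → Inc y z)
    by-cases (yes sole) = subst (ℕ._≤ ∑ Sᵢ (λ y → Inc y z)) (trans (Inc-adjacent p~z) (F-sole sole))
                            (∑-member (λ y → Inc y z) (in-Sᵢ lvp≡i))
    by-cases (no ¬sole) with another-parent (λ only → ¬sole (lvz≡1+i , Adj⇒dist≡1 p~z , only))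
    ... | q , z~q , lvq≡i , q≢p =
      ℕ.≤-trans (ℕ.+-mono-≤ (gives-1 p~z) (gives-1 (symmetric z q z~q)))
                (∑-pair _≟ᵥ_ (λ y → Inc y z) uniq (in-Sᵢ lvp≡i) (in-Sᵢ lvq≡i) (q≢p ∘ sym))

  count : ∀ {Sᵢ S₊} → Enumerates G dist x i Sᵢ → Enumerates G dist x (suc i) S₊ →
    2 ℕ.* length S₊ ℕ.≤ ∑ Sᵢ T
  count {Sᵢ} {S₊} enumᵢ (uniq₊ , enum₊) = begin
    2 ℕ.* length S₊
      ≡⟨ ℕ.*-comm 2 (length S₊) ⟩
    length S₊ ℕ.* 2
      ≡⟨ ∑-const S₊ 2 ⟨
    ∑ S₊ (λ _ → 2)
      ≤⟨ ∑-mono S₊ (λ z∈ → Inc-≥-2 enumᵢ (Equivalence.to (enum₊ _) z∈)) ⟩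
    ∑ S₊ (λ z → ∑ Sᵢ (λ y → Inc y z))
      ≡⟨ ∑-swap Sᵢ S₊ Inc ⟨
    ∑ Sᵢ (λ y → ∑ S₊ (Inc y))
      ≤⟨ ∑-mono Sᵢ (λ {y} _ → Inc-≤-T uniq₊ y) ⟩
    ∑ Sᵢ T ∎
    where open ℕ.≤-Reasoning

theorem4p4 : {V : Set} (d : ℕ) (G : RegularGraph V d) → Connected G →
    (dist : V → V → ℕ) → IsGraphDist G dist →
    (k : ℚ) → (∀ v₁ v₂ → v₁ ≢ v₂ → CurvatureAtLeast G dist v₁ v₂ k) →
    (x : V) (i : ℕ) → i ≥ 1 →
    (Sᵢ Sᵢ₊₁ : List V) → Enumerates G dist x i Sᵢ → Enumerates G dist x (suc i) Sᵢ₊₁ →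
    ℕ→ℚ (length Sᵢ₊₁) ≤ (½ * (ℕ→ℚ d + 1ℚ - ℕ→ℚ 2 * ℕ→ℚ d * k)) * ℕ→ℚ (length Sᵢ)
theorem4p4 d G _ dist isDist k curv x i i≥1 Sᵢ Sᵢ₊₁ enumᵢ enum₊ = begin
  ℕ→ℚ (length Sᵢ₊₁)
    ≡⟨ ℕ→ℚ-half-double (length Sᵢ₊₁) ⟩
  ½ * ℕ→ℚ (2 ℕ.* length Sᵢ₊₁)
    ≤⟨ ℚ.*-monoˡ-≤-nonNeg ½ (ℕ→ℚ-mono (count enumᵢ enum₊)) ⟩
  ½ * ℕ→ℚ (∑ Sᵢ T)
    ≤⟨ ℚ.*-monoˡ-≤-nonNeg ½ (ℕ→ℚ-∑-≤ Sᵢ T R T≤R) ⟩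
  ½ * (ℕ→ℚ (length Sᵢ) * R)
    ≡⟨ solve 2 (λ s r → con ½ :* (s :* r) := (con ½ :* r) :* s) refl (ℕ→ℚ (length Sᵢ)) R ⟩
  (½ * R) * ℕ→ℚ (length Sᵢ) ∎
  where
  open ℚ.≤-Reasoning
  open Levels G dist isDist x i
  R : ℚ
  R = ℕ→ℚ d + 1ℚ - ℕ→ℚ 2 * ℕ→ℚ d * k
  T≤R : ∀ {y} → y ∈ Sᵢ → ℕ→ℚ (T y) ≤ R
  T≤R y∈Sᵢ = local-bound k curv i≥1 (Equivalence.to (proj₂ enumᵢ _) y∈Sᵢ)
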